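{- Let $S\subseteq\{0,1\}^n$ be an up-monotone cube-ideal set-system with connectivity $\lambda\geq1$. Then $S$ has VC dimension at least $(1-1/\lambda)n$.
   Context: A set-system is a subset $S\subseteq\{0,1\}^n$ with convex hull $\mathrm{conv}(S)$. It is up-monotone if $p\geq q$ (coordinatewise) with $p,q\in\{0,1\}^n$ and $q\in S$ imply $p\in S$. A GSC inequality is $\sum_{i\in I}x_i+\sum_{j\in J}(1-x_j)\geq1$ for disjoint $I,J\subseteq[n]$, using $|I|+|J|$ variables; capacity inequalities are $x_i\geq0$, $x_i\leq1$. $S$ is cube-ideal if $\mathrm{conv}(S)$ is the solution set of a finite family of capacity and GSC inequalities. The connectivity of $S$ is the minimum number of variables in a GSC inequality valid for $\mathrm{conv}(S)$ ($+\infty$ if $S=\{0,1\}^n$, with $1/\lambda$ then read as $0$). The VC dimension of $S$ is the largest $d$ such that for some $I\subseteq[n]$ with $|I|=d$, the restrictions $\{p_I:p\in S\}$ give all of $\{0,1\}^I$ ($0$ if $S=\emptyset$). -}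

module Defs where

open import Data.Bool using (Bool; true; false; if_then_else_)
open import Data.Nat as ℕ using (ℕ; zero; suc)
open import Data.Fin using (Fin)
import Data.Fin as F
open import Data.Fin.Subset using (Subset; _∈_; _∩_; Empty; ∣_∣)
open import Data.Vec using (Vec; lookup)
open import Data.List using (List; map; sum)
open import Data.List.Relation.Unary.All using (All)
open import Data.Rational as ℚ using (ℚ; 0ℚ; 1ℚ)
open import Data.Product using (Σ; ∃; _×_; _,_; proj₁)
open import Data.Sum using (_⊎_)
open import Relation.Binary.PropositionalEquality using (_≡_)
open import Function using (_⇔_)

Point : ℕ → Set
Point n = Vec Bool n

SetSystem : ℕ → Set₁
SetSystem n = Point n → Set

_≥ₚ_ : ∀ {n} → Point n → Point n → Set
_≥ₚ_ {n} p q = ∀ (i : Fin n) → lookup q i ≡ true → lookup p i ≡ true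

UpMonotone : ∀ {n} → SetSystem n → Set
UpMonotone {n} S = ∀ (p q : Point n) → p ≥ₚ q → S q → S p

b2q : Bool → ℚ
b2q true  = 1ℚ
b2q false = 0ℚ

ΣFin : ∀ n → (Fin n → ℚ) → ℚ
ΣFin zero    f = 0ℚ
ΣFin (suc n) f = f F.zero ℚ.+ ΣFin n (λ i → f (F.suc i))

-- Rational points of the convex hull of S: finite convex combinations of points of S.
InConv : ∀ {n} → SetSystem n → (Fin n → ℚ) → Set
InConv {n} S x =
  Σ (List (ℚ × Point n)) λ ws →
    All (λ wp → (0ℚ ℚ.≤ proj₁ wp) × S (Data.Product.proj₂ wp)) ws
    × sum' (map proj₁ ws) ≡ 1ℚ
    × (∀ i → x i ≡ sum' (map (λ wp → proj₁ wp ℚ.* b2q (lookup (Data.Product.proj₂ wp) i)) ws))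
  where
  sum' : List ℚ → ℚ
  sum' = Data.List.foldr ℚ._+_ 0ℚ

data Ineq (n : ℕ) : Set where
  lower : Fin n → Ineq n
  upper : Fin n → Ineq n
  gsc   : (I J : Subset n) → Empty (I ∩ J) → Ineq n

gscLHS : ∀ {n} → Subset n → Subset n → (Fin n → ℚ) → ℚ
gscLHS {n} I J x =
  ΣFin n (λ i → if lookup I i then x i else 0ℚ)
  ℚ.+ ΣFin n (λ j → if lookup J j then 1ℚ ℚ.- x j else 0ℚ)

Satisfies : ∀ {n} → Ineq n → (Fin n → ℚ) → Set
Satisfies (lower i)   x = 0ℚ ℚ.≤ x i
Satisfies (upper i)   x = x i ℚ.≤ 1ℚ
Satisfies (gsc I J _) x = 1ℚ ℚ.≤ gscLHS I J x

CubeIdeal : ∀ {n} → SetSystem n → Set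
CubeIdeal {n} S =
  Σ (List (Ineq n)) λ ineqs →
    ∀ (x : Fin n → ℚ) → InConv S x ⇔ All (λ c → Satisfies c x) ineqs

ValidGSC : ∀ {n} → SetSystem n → (I J : Subset n) → Set
ValidGSC {n} S I J = ∀ (x : Fin n → ℚ) → InConv S x → 1ℚ ℚ.≤ gscLHS I J x

data ℕ∞ : Set where
  fin : ℕ → ℕ∞
  ∞   : ℕ∞

Connectivity : ∀ {n} → SetSystem n → ℕ∞ → Set
Connectivity {n} S (fin l) =
  (Σ (Subset n) λ I → Σ (Subset n) λ J →
     Empty (I ∩ J) × ValidGSC S I J × ∣ I ∣ ℕ.+ ∣ J ∣ ≡ l)
  × (∀ (I J : Subset n) → Empty (I ∩ J) → ValidGSC S I J → l ℕ.≤ ∣ I ∣ ℕ.+ ∣ J ∣)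
Connectivity {n} S ∞ =
  ∀ (I J : Subset n) → Empty (I ∩ J) → ValidGSC S I J → Data.Empty.⊥
  where import Data.Empty

OneLe : ℕ∞ → Set
OneLe (fin l) = 1 ℕ.≤ l
OneLe ∞       = Data.Unit.⊤
  where import Data.Unit

Shatters : ∀ {n} → SetSystem n → Subset n → Set
Shatters {n} S I =
  ∀ (f : Point n) → Σ (Point n) λ p → S p × (∀ i → i ∈ I → lookup p i ≡ lookup f i)

-- VC dimension d satisfies d ≥ (1 - 1/λ) n  (1/∞ read as 0);
-- for finite λ ≥ 1 this is λ·d ≥ (λ-1)·n.
MeetsBound : ℕ∞ → ℕ → ℕ → Set
MeetsBound (fin l) n d = (l ℕ.∸ 1) ℕ.* n ℕ.≤ l ℕ.* d
MeetsBound ∞       n d = n ℕ.≤ d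

-- VC dimension of S is at least (1 - 1/λ) n: some shattered I has |I| meeting the bound
-- (the VC dimension is the largest such |I|).
VCDimAtLeast : ∀ {n} → SetSystem n → ℕ∞ → Set
VCDimAtLeast {n} S λ' = Σ (Subset n) λ I → Shatters S I × MeetsBound λ' n ∣ I ∣

-- The uniform point (1/λ, …, 1/λ) lies in conv(S): it satisfies the capacity inequalities,
-- and a valid GSC inequality has at least λ variables, each contributing at least
-- min(1/λ, 1 − 1/λ) = 1/λ to its left-hand side.  Writing the point as a convex combination
-- of points of S exhibits its coordinate sum n/λ as an average of their sizes, so some
-- p ∈ S has |p| ≤ n/λ.  Since S is up-monotone, every superset of p lies in S, so S
-- shatters the complement of p, of size at least (1 − 1/λ)n.  For λ = ∞ the uniform point
-- is 0, and for λ = 1 any point of S will do.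
{-# OPTIONS --safe #-}
module Submission where

open import Defs
open import Data.Bool using (true; false; if_then_else_; _∨_)
open import Data.Bool.Properties using (¬-not)
open import Data.Empty using (⊥-elim)
open import Data.Fin using (Fin)
import Data.Fin as Fin
open import Data.Fin.Subset using (Subset; _∈_; ∁; _∩_; _∪_; Empty; ∣_∣; ⊤; ⊥)
open import Data.Fin.Subset.Properties using (∉⊥; ∩-idem; ∣⊥∣≡0; ∣∁p∣≡n∸∣p∣; x∈∁p⇒x∉p)
open import Data.List using (List; []; _∷_; foldr; map)
open import Data.List.Properties using (map-cong)
open import Data.List.Membership.Propositional using () renaming (_∈_ to _∈ᴸ_)
import Data.List.Relation.Unary.All as All
open All using (All; []; _∷_)
open import Data.Nat as ℕ using (ℕ; zero; suc; z≤n; s≤s)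
import Data.Nat.Properties as ℕₚ
open import Data.Product using (Σ; Σ-syntax; _×_; _,_; proj₁; proj₂; map₂)
open import Data.Rational as ℚ using (ℚ; 0ℚ; 1ℚ; _≤_; _<_; _+_; _*_; _-_; 1/_)
import Data.Rational.Properties as ℚₚ
open import Data.Vec using (lookup; []; _∷_)
import Data.Vec.Properties as Vecₚ
open import Function using (_∘_; Equivalence)
open import Algebra.Bundles using (Ring)
open import Relation.Binary.Bundles using (DecTotalOrder)
open import Relation.Binary.PropositionalEquality
open import Relation.Nullary using (¬_; Dec; yes; no)
open import Relation.Nullary.Decidable using (map′)

open import Algebra.Properties.Group ℚₚ.+-0-group using (x≈z//y)
-- m · x is the m-fold sum x + ⋯ + x; m · 1ℚ serves as the embedding of ℕ into ℚ.
open import Algebra.Properties.Semiring.Mult (Ring.semiring ℚₚ.+-*-ring)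
  using (×-homo-1; ×-homo-+; ×-assocˡ; ×-assoc-*) renaming (_×_ to _·_)
open import Algebra.Properties.Semiring.Sum (Ring.semiring ℚₚ.+-*-ring)
  using (sum; sum-cong-≗; sum-replicate; sum-replicate-zero; ∑-distrib-+; *-distribˡ-sum)
open import Data.List.Extrema (DecTotalOrder.totalOrder ℚₚ.≤-decTotalOrder)
  using (argmin; argmin-all; f[argmin]≤f[⊤]; f[argmin]≤f[xs])

0≤1 : 0ℚ ≤ 1ℚ
0≤1 = ℚₚ.nonNegative⁻¹ 1ℚ

x<1+x : ∀ x → x < 1ℚ + x
x<1+x x = subst (_< 1ℚ + x) (ℚₚ.+-identityˡ x) (ℚₚ.+-mono-<-≤ (ℚₚ.positive⁻¹ 1ℚ) (ℚₚ.≤-refl {x}))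

·-nonNeg : ∀ m {x} → 0ℚ ≤ x → 0ℚ ≤ m · x
·-nonNeg zero    x≥0 = ℚₚ.≤-refl
·-nonNeg (suc m) x≥0 = ℚₚ.+-mono-≤ x≥0 (·-nonNeg m x≥0)

·-monoˡ-≤ : ∀ {x} → 0ℚ ≤ x → ∀ {m n} → m ℕ.≤ n → m · x ≤ n · x
·-monoˡ-≤ x≥0 {n = n} z≤n     = ·-nonNeg n x≥0
·-monoˡ-≤ {x} x≥0     (s≤s m≤n) = ℚₚ.+-monoʳ-≤ x (·-monoˡ-≤ x≥0 m≤n)

·-monoʳ-≤ : ∀ m {x y} → x ≤ y → m · x ≤ m · y
·-monoʳ-≤ zero    x≤y = ℚₚ.≤-refl
·-monoʳ-≤ (suc m) x≤y = ℚₚ.+-mono-≤ x≤y (·-monoʳ-≤ m x≤y)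

·1-pos : ∀ m → 0ℚ < suc m · 1ℚ
·1-pos m = ℚₚ.≤-<-trans (·-nonNeg m 0≤1) (x<1+x (m · 1ℚ))

·1-cancel-≤ : ∀ {m n} → m · 1ℚ ≤ n · 1ℚ → m ℕ.≤ n
·1-cancel-≤ {n = n} m≤n = ℕₚ.≮⇒≥ λ n<m →
  ℚₚ.<-irrefl refl (ℚₚ.<-≤-trans (x<1+x (n · 1ℚ)) (ℚₚ.≤-trans (·-monoˡ-≤ 0≤1 n<m) m≤n))

ΣFin≡sum : ∀ n (f : Fin n → ℚ) → ΣFin n f ≡ sum f
ΣFin≡sum zero    f = refl
ΣFin≡sum (suc n) f = cong (f Fin.zero +_) (ΣFin≡sum n (f ∘ Fin.suc))

sum-select : ∀ {n} (I : Subset n) a → sum (λ i → if lookup I i then a else 0ℚ) ≡ ∣ I ∣ · a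
sum-select []          a = refl
sum-select (true ∷ I)  a = cong (a +_) (sum-select I a)
sum-select (false ∷ I) a = trans (ℚₚ.+-identityˡ _) (sum-select I a)

sum-foldr-comm : ∀ {A : Set} {n} (g : Fin n → A → ℚ) (as : List A) →
  sum (λ i → foldr _+_ 0ℚ (map (g i) as)) ≡ foldr _+_ 0ℚ (map (λ a → sum (λ i → g i a)) as)
sum-foldr-comm {n = n} g []       = sum-replicate-zero n
sum-foldr-comm         g (a ∷ as) =
  trans (∑-distrib-+ (λ i → g i a) _) (cong (sum (λ i → g i a) +_) (sum-foldr-comm g as))

weight : ∀ {n} → Point n → ℚ
weight p = sum (λ i → b2q (lookup p i))

weight≡∣∣·1 : ∀ {n} (p : Point n) → weight p ≡ ∣ p ∣ · 1ℚ
weight≡∣∣·1 p = trans (sum-cong-≗ (b2q≡if ∘ lookup p)) (sum-select p 1ℚ)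
  where
  b2q≡if : ∀ b → b2q b ≡ (if b then 1ℚ else 0ℚ)
  b2q≡if true  = refl
  b2q≡if false = refl

totalWeight : ∀ {A : Set} → List (ℚ × A) → ℚ
totalWeight ws = foldr _+_ 0ℚ (map proj₁ ws)

module _ {A : Set} (f : A → ℚ) where

  weightedSum : List (ℚ × A) → ℚ
  weightedSum ws = foldr _+_ 0ℚ (map (λ wa → proj₁ wa * f (proj₂ wa)) ws)

  totalWeight*≤weightedSum : ∀ {m} ws → All (λ wa → 0ℚ ≤ proj₁ wa) ws →
    All (λ wa → m ≤ f (proj₂ wa)) ws → totalWeight ws * m ≤ weightedSum ws
  totalWeight*≤weightedSum {m} [] [] [] = ℚₚ.≤-reflexive (ℚₚ.*-zeroˡ m)
  totalWeight*≤weightedSum {m} ((w , a) ∷ ws) (w≥0 ∷ ws≥0) (m≤fa ∷ m≤fws) = begin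
    (w + totalWeight ws) * m        ≡⟨ ℚₚ.*-distribʳ-+ m w (totalWeight ws) ⟩
    w * m + totalWeight ws * m      ≤⟨ ℚₚ.+-mono-≤ (ℚₚ.*-monoˡ-≤-nonNeg w {{ℚ.nonNegative w≥0}} m≤fa)
                                                    (totalWeight*≤weightedSum ws ws≥0 m≤fws) ⟩
    w * f a + weightedSum ws        ∎
    where open ℚₚ.≤-Reasoning

sum≡weightedSum : ∀ {n} {x : Fin n → ℚ} (ws : List (ℚ × Point n)) →
  (∀ i → x i ≡ foldr _+_ 0ℚ (map (λ wp → proj₁ wp * b2q (lookup (proj₂ wp) i)) ws)) →
  sum x ≡ weightedSum weight ws
sum≡weightedSum {x = x} ws x≡ = begin
  sum x
    ≡⟨ sum-cong-≗ x≡ ⟩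
  sum (λ i → foldr _+_ 0ℚ (map (coordinate i) ws))
    ≡⟨ sum-foldr-comm coordinate ws ⟩
  foldr _+_ 0ℚ (map (λ wp → sum (λ i → coordinate i wp)) ws)
    ≡⟨ cong (foldr _+_ 0ℚ) (map-cong (λ wp → sym (*-distribˡ-sum (proj₁ wp) (b2q ∘ lookup (proj₂ wp))))
                                     ws) ⟩
  weightedSum weight ws
    ∎
  where
  open ≡-Reasoning
  coordinate : Fin _ → ℚ × Point _ → ℚ
  coordinate i wp = proj₁ wp * b2q (lookup (proj₂ wp) i)

InConv⇒∃-weight≤sum : ∀ {n} {S : SetSystem n} {x} → InConv S x →
  Σ[ p ∈ Point n ] S p × weight p ≤ sum x
InConv⇒∃-weight≤sum ([] , _ , () , _)
InConv⇒∃-weight≤sum {S = S} {x} (ws@(wp ∷ ws′) , ws∈S , total≡1 , x≡) =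
  proj₂ best , best∈S , (begin
    weight (proj₂ best)                 ≡⟨ ℚₚ.*-identityˡ _ ⟨
    1ℚ * weight (proj₂ best)            ≡⟨ cong (_* weight (proj₂ best)) total≡1 ⟨
    totalWeight ws * f best             ≤⟨ totalWeight*≤weightedSum weight ws (All.map proj₁ ws∈S)
                                             (f[argmin]≤f[⊤] {f = f} wp ws′
                                               ∷ f[argmin]≤f[xs] {f = f} wp ws′) ⟩
    weightedSum weight ws               ≡⟨ sum≡weightedSum ws x≡ ⟨
    sum x                               ∎)
  where
  open ℚₚ.≤-Reasoning
  f : ℚ × Point _ → ℚ
  f = weight ∘ proj₂
  best : ℚ × Point _
  best = argmin f wp ws′
  best∈S : S (proj₂ best)
  best∈S = argmin-all f {P = S ∘ proj₂} (proj₂ (All.head ws∈S))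
                                          (All.map proj₂ (All.tail ws∈S))

satisfies? : ∀ {n} (c : Ineq n) x → Dec (Satisfies c x)
satisfies? (lower i)   x = 0ℚ ℚₚ.≤? x i
satisfies? (upper i)   x = x i ℚₚ.≤? 1ℚ
satisfies? (gsc I J _) x = 1ℚ ℚₚ.≤? gscLHS I J x

InConv? : ∀ {n} {S : SetSystem n} → CubeIdeal S → ∀ x → Dec (InConv S x)
InConv? (ineqs , conv⇔solutions) x =
  map′ (Equivalence.from (conv⇔solutions x)) (Equivalence.to (conv⇔solutions x))
       (All.all? (λ c → satisfies? c x) ineqs)

InConv-intro : ∀ {n} {S : SetSystem n} {x} → CubeIdeal S →
  (∀ i → 0ℚ ≤ x i) → (∀ i → x i ≤ 1ℚ) →
  (∀ I J → Empty (I ∩ J) → ValidGSC S I J → 1ℚ ≤ gscLHS I J x) → InConv S x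
InConv-intro {x = x} (ineqs , conv⇔solutions) x≥0 x≤1 validGSC⇒satisfied =
  Equivalence.from (conv⇔solutions x) (All.tabulate satisfied)
  where
  satisfied : ∀ {c} → c ∈ᴸ ineqs → Satisfies c x
  satisfied {lower i}   _  = x≥0 i
  satisfied {upper i}   _  = x≤1 i
  satisfied {gsc I J d} c∈ = validGSC⇒satisfied I J d λ y y∈conv →
    All.lookup (Equivalence.to (conv⇔solutions y) y∈conv) c∈

vertex∈conv : ∀ {n} {S : SetSystem n} {p} → S p → InConv S (b2q ∘ lookup p)
vertex∈conv p∈S =
  (1ℚ , _) ∷ [] , (0≤1 , p∈S) ∷ [] , refl , λ i → sym (trans (ℚₚ.+-identityʳ _) (ℚₚ.*-identityˡ _))

∁-shattered : ∀ {n} {S : SetSystem n} {p} → UpMonotone S → S p → Shatters S (∁ p)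
∁-shattered {p = p} up p∈S f = p ∪ f , up (p ∪ f) p p∪f≥p p∈S , p∪f≡f-on-∁p
  where
  lookup-∪ : ∀ i → lookup (p ∪ f) i ≡ lookup p i ∨ lookup f i
  lookup-∪ i = Vecₚ.lookup-zipWith _∨_ i p f

  p∪f≥p : (p ∪ f) ≥ₚ p
  p∪f≥p i pᵢ≡true = trans (lookup-∪ i) (cong (_∨ lookup f i) pᵢ≡true)

  p∪f≡f-on-∁p : ∀ i → i ∈ ∁ p → lookup (p ∪ f) i ≡ lookup f i
  p∪f≡f-on-∁p i i∈∁p = trans (lookup-∪ i) (cong (_∨ lookup f i) pᵢ≡false)
    where
    pᵢ≡false : lookup p i ≡ false
    pᵢ≡false = ¬-not (x∈∁p⇒x∉p i∈∁p ∘ Vecₚ.lookup⇒[]= i p)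

-- A point of S puts ⊤ in S, so if ⊤ ∉ conv S then S is empty and even the empty
-- GSC inequality 0 ≥ 1 is valid.
nonempty : ∀ {n} {S : SetSystem n} → UpMonotone S → CubeIdeal S → ¬ ValidGSC S ⊥ ⊥ →
  Σ (Point n) S
nonempty up cubeIdeal ∅-invalid with InConv? cubeIdeal (b2q ∘ lookup ⊤)
... | yes ⊤∈conv = map₂ proj₁ (InConv⇒∃-weight≤sum ⊤∈conv)
... | no  ⊤∉conv = ⊥-elim (∅-invalid λ x x∈conv →
  let p , p∈S , _ = InConv⇒∃-weight≤sum x∈conv
  in ⊥-elim (⊤∉conv (vertex∈conv (up ⊤ p (λ i _ → Vecₚ.lookup-replicate i true) p∈S))))

∅-GSC-invalid : ∀ {n} {S : SetSystem n} {l} → Connectivity S (fin (suc l)) → ¬ ValidGSC S ⊥ ⊥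
∅-GSC-invalid {n} (_ , minimal) valid =
  ℕₚ.n≮0 (subst (λ k → _ ℕ.≤ k ℕ.+ k) (∣⊥∣≡0 n) (minimal ⊥ ⊥ ⊥∩⊥-empty valid))
  where
  ⊥∩⊥-empty : Empty (⊥ ∩ ⊥)
  ⊥∩⊥-empty = subst Empty (sym (∩-idem ⊥)) λ (_ , x∈⊥) → ∉⊥ x∈⊥

module UniformPoint (k : ℕ) where

  L : ℕ
  L = suc (suc k)

  instance
    L·1-positive : ℚ.Positive (L · 1ℚ)
    L·1-positive = ℚ.positive (·1-pos (suc k))

    L·1-nonZero : ℚ.NonZero (L · 1ℚ)
    L·1-nonZero = ℚₚ.pos⇒nonZero (L · 1ℚ)

  c : ℚ
  c = 1/ (L · 1ℚ)

  c≥0 : 0ℚ ≤ c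
  c≥0 = ℚₚ.<⇒≤ (ℚₚ.positive⁻¹ c {{ℚₚ.1/pos⇒pos (L · 1ℚ)}})

  L·c≡1 : L · c ≡ 1ℚ
  L·c≡1 = begin
    L · c             ≡⟨ cong (L ·_) (ℚₚ.*-identityˡ c) ⟨
    L · (1ℚ * c)      ≡⟨ ×-assoc-* L 1ℚ c ⟨
    (L · 1ℚ) * c      ≡⟨ ℚₚ.*-inverseʳ (L · 1ℚ) ⟩
    1ℚ                ∎
    where open ≡-Reasoning

  c≤1 : c ≤ 1ℚ
  c≤1 = begin
    c        ≡⟨ ×-homo-1 c ⟨
    1 · c    ≤⟨ ·-monoˡ-≤ c≥0 {1} {L} (s≤s z≤n) ⟩
    L · c    ≡⟨ L·c≡1 ⟩
    1ℚ       ∎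
    where open ℚₚ.≤-Reasoning

  1-c≡[1+k]·c : 1ℚ - c ≡ suc k · c
  1-c≡[1+k]·c = sym (x≈z//y (suc k · c) c 1ℚ (trans (ℚₚ.+-comm (suc k · c) c) L·c≡1))

  gscLHS-uniform : ∀ {n} (I J : Subset n) →
    gscLHS I J (λ _ → c) ≡ (∣ I ∣ ℕ.+ ∣ J ∣ ℕ.* suc k) · c
  gscLHS-uniform {n} I J = begin
    gscLHS I J (λ _ → c)
      ≡⟨ cong₂ _+_ (ΣFin≡sum n (λ i → if lookup I i then c else 0ℚ))
                   (ΣFin≡sum n (λ j → if lookup J j then 1ℚ - c else 0ℚ)) ⟩
    sum (λ i → if lookup I i then c else 0ℚ) + sum (λ j → if lookup J j then 1ℚ - c else 0ℚ)
      ≡⟨ cong₂ _+_ (sum-select I c) (sum-select J (1ℚ - c)) ⟩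
    ∣ I ∣ · c + ∣ J ∣ · (1ℚ - c)
      ≡⟨ cong (λ y → ∣ I ∣ · c + ∣ J ∣ · y) 1-c≡[1+k]·c ⟩
    ∣ I ∣ · c + ∣ J ∣ · suc k · c
      ≡⟨ cong (∣ I ∣ · c +_) (×-assocˡ c ∣ J ∣ (suc k)) ⟩
    ∣ I ∣ · c + (∣ J ∣ ℕ.* suc k) · c
      ≡⟨ ×-homo-+ c ∣ I ∣ (∣ J ∣ ℕ.* suc k) ⟨
    (∣ I ∣ ℕ.+ ∣ J ∣ ℕ.* suc k) · c
      ∎
    where open ≡-Reasoning

  uniform-satisfies-GSC : ∀ {n} (I J : Subset n) → L ℕ.≤ ∣ I ∣ ℕ.+ ∣ J ∣ →
    1ℚ ≤ gscLHS I J (λ _ → c)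
  uniform-satisfies-GSC I J L≤∣I∣+∣J∣ = begin
    1ℚ                                ≡⟨ L·c≡1 ⟨
    L · c                             ≤⟨ ·-monoˡ-≤ c≥0 (ℕₚ.≤-trans L≤∣I∣+∣J∣
                                           (ℕₚ.+-monoʳ-≤ ∣ I ∣ (ℕₚ.m≤m*n ∣ J ∣ (suc k)))) ⟩
    (∣ I ∣ ℕ.+ ∣ J ∣ ℕ.* suc k) · c   ≡⟨ gscLHS-uniform I J ⟨
    gscLHS I J (λ _ → c)              ∎
    where open ℚₚ.≤-Reasoning

  ∃-small-point : ∀ {n} {S : SetSystem n} → CubeIdeal S → Connectivity S (fin L) →
    Σ[ p ∈ Point n ] S p × L ℕ.* ∣ p ∣ ℕ.≤ n
  ∃-small-point {n} {S} cubeIdeal (_ , minimal) =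
    let p , p∈S , weight≤sum = InConv⇒∃-weight≤sum uniform∈conv
    in  p , p∈S , ·1-cancel-≤ (begin
      (L ℕ.* ∣ p ∣) · 1ℚ   ≡⟨ ×-assocˡ 1ℚ L ∣ p ∣ ⟨
      L · ∣ p ∣ · 1ℚ       ≡⟨ cong (L ·_) (weight≡∣∣·1 p) ⟨
      L · weight p         ≤⟨ ·-monoʳ-≤ L weight≤sum ⟩
      L · sum {n} (λ _ → c) ≡⟨ cong (L ·_) (sum-replicate n {c}) ⟩
      L · n · c            ≡⟨ ×-assocˡ c L n ⟩
      (L ℕ.* n) · c        ≡⟨ cong (_· c) (ℕₚ.*-comm L n) ⟩
      (n ℕ.* L) · c        ≡⟨ ×-assocˡ c n L ⟨
      n · L · c            ≡⟨ cong (n ·_) L·c≡1 ⟩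
      n · 1ℚ               ∎)
    where
    open ℚₚ.≤-Reasoning
    uniform∈conv : InConv S (λ _ → c)
    uniform∈conv = InConv-intro cubeIdeal (λ _ → c≥0) (λ _ → c≤1) λ I J I∩J≡∅ valid →
      uniform-satisfies-GSC I J (minimal I J I∩J≡∅ valid)

∃-empty-point : ∀ {n} {S : SetSystem n} → CubeIdeal S → Connectivity S ∞ →
  Σ[ p ∈ Point n ] S p × ∣ p ∣ ≡ 0
∃-empty-point {n} {S} cubeIdeal noValidGSC =
  let p , p∈S , weight≤0 = InConv⇒∃-weight≤sum origin∈conv
  in  p , p∈S , ℕₚ.n≤0⇒n≡0
                  (·1-cancel-≤ (subst₂ _≤_ (weight≡∣∣·1 p) (sum-replicate-zero n) weight≤0))
  where
  origin∈conv : InConv S (λ _ → 0ℚ)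
  origin∈conv = InConv-intro cubeIdeal (λ _ → ℚₚ.≤-refl) (λ _ → 0≤1) λ I J I∩J≡∅ valid →
    ⊥-elim (noValidGSC I J I∩J≡∅ valid)

l*m≤n⇒[l∸1]*n≤l*[n∸m] : ∀ l m {n} → l ℕ.* m ℕ.≤ n → (l ℕ.∸ 1) ℕ.* n ℕ.≤ l ℕ.* (n ℕ.∸ m)
l*m≤n⇒[l∸1]*n≤l*[n∸m] l m {n} lm≤n = begin
  (l ℕ.∸ 1) ℕ.* n           ≡⟨ ℕₚ.*-distribʳ-∸ n l 1 ⟩
  l ℕ.* n ℕ.∸ 1 ℕ.* n       ≡⟨ cong (l ℕ.* n ℕ.∸_) (ℕₚ.*-identityˡ n) ⟩
  l ℕ.* n ℕ.∸ n             ≤⟨ ℕₚ.∸-monoʳ-≤ (l ℕ.* n) lm≤n ⟩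
  l ℕ.* n ℕ.∸ l ℕ.* m       ≡⟨ ℕₚ.*-distribˡ-∸ l n m ⟨
  l ℕ.* (n ℕ.∸ m)           ∎
  where open ℕₚ.≤-Reasoning

∃-point-meeting-bound : ∀ {n} {S : SetSystem n} λ' → UpMonotone S → CubeIdeal S →
  Connectivity S λ' → OneLe λ' → Σ[ p ∈ Point n ] S p × MeetsBound λ' n (n ℕ.∸ ∣ p ∣)
∃-point-meeting-bound (fin 1) up cubeIdeal conn _ =
  map₂ (_, z≤n) (nonempty up cubeIdeal (∅-GSC-invalid conn))
∃-point-meeting-bound (fin (suc (suc k))) _ cubeIdeal conn _ =
  let p , p∈S , L*∣p∣≤n = UniformPoint.∃-small-point k cubeIdeal conn
  in  p , p∈S , l*m≤n⇒[l∸1]*n≤l*[n∸m] (suc (suc k)) ∣ p ∣ L*∣p∣≤n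
∃-point-meeting-bound {n} ∞ _ cubeIdeal noValidGSC _ =
  let p , p∈S , ∣p∣≡0 = ∃-empty-point cubeIdeal noValidGSC
  in  p , p∈S , subst (λ k → n ℕ.≤ n ℕ.∸ k) (sym ∣p∣≡0) ℕₚ.≤-refl

theorem5p2 : ∀ (n : ℕ) (S : SetSystem n) (λ' : ℕ∞) → UpMonotone S → CubeIdeal S → Connectivity S λ' → OneLe λ' → VCDimAtLeast S λ'
theorem5p2 n S λ' up cubeIdeal conn 1≤λ =
  let p , p∈S , bound = ∃-point-meeting-bound λ' up cubeIdeal conn 1≤λ
  in  ∁ p , ∁-shattered up p∈S , subst (MeetsBound λ' n) (sym (∣∁p∣≡n∸∣p∣ p)) bound
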